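{- Let $G=(V,E)$ be a finite tree. In either the simultaneous or the alternating variant of the two-player guessing game on $G$, there exists a correct strategy (agreed upon in advance) under which, in every placement, both players eventually announce their own positions.
   Context: The game: two players $A$ and $B$ are placed on the endpoints of an edge; a placement is an ordered pair $(a,b)$ with $\{a,b\}\in E$, meaning $A$ sits at $a$ and $B$ at $b$. Each player knows $G$ and the vertex of the other player, but not their own vertex. Time proceeds in discrete steps $t=1,2,\dots$. In the simultaneous variant, at each step each player either stays silent or announces a vertex (claiming it is their own position), both acting at the same time. In the alternating variant, $A$ may speak only at odd steps and $B$ only at even steps. All announcements are heard by both players. A strategy specifies for each player, as a function of $G$, the other player's vertex and the history of announcements so far, whether to stay silent or which vertex to announce at each step. A strategy is correct if in every placement, whenever a player announces a vertex, it is that player's actual position. -}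

module Defs where

open import Data.Nat using (ℕ; zero; suc; _≤_)
open import Data.Fin using (Fin)
open import Data.Bool using (Bool; true; false; if_then_else_)
open import Data.Maybe using (Maybe; just; nothing)
open import Data.List using (List; []; _∷_; length; head; last)
open import Data.List.Relation.Unary.Unique.Propositional using (Unique)
open import Data.Product using (_×_; Σ; ∃; ∃-syntax; _,_; proj₁; proj₂)
open import Relation.Binary.PropositionalEquality using (_≡_)
open import Relation.Nullary using (¬_)

record Graph (n : ℕ) : Set where
  field
    adj     : Fin n → Fin n → Bool
    symm    : ∀ u v → adj u v ≡ true → adj v u ≡ true
    irrefl  : ∀ v → adj v v ≡ false

open Graph public

Edge : ∀ {n} → Graph n → Fin n → Fin n → Set
Edge G u v = adj G u v ≡ true

data Chain {n} (G : Graph n) : List (Fin n) → Set where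
  nil  : Chain G []
  one  : ∀ v → Chain G (v ∷ [])
  cons : ∀ {v w vs} → Edge G v w → Chain G (w ∷ vs) → Chain G (v ∷ w ∷ vs)

Reachable : ∀ {n} → Graph n → Fin n → Fin n → Set
Reachable G u v =
  ∃[ vs ] (Chain G vs × head vs ≡ just u × last vs ≡ just v)

Connected : ∀ {n} → Graph n → Set
Connected G = ∀ u v → Reachable G u v

IsCycle : ∀ {n} → Graph n → List (Fin n) → Set
IsCycle G cs =
  Chain G cs × Unique cs × 3 ≤ length cs ×
  ∃[ u ] ∃[ w ] (head cs ≡ just u × last cs ≡ just w × Edge G w u)

Acyclic : ∀ {n} → Graph n → Set
Acyclic G = ¬ (∃[ cs ] IsCycle G cs)

IsTree : ∀ {n} → Graph n → Set
IsTree G = Connected G × Acyclic G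

-- an action at one step: stay silent (nothing) or announce a vertex
Action : ℕ → Set
Action n = Maybe (Fin n)

-- A player's strategy (for the fixed graph G): given the other player's
-- vertex and the history of announcements so far, choose an action.
-- Histories are lists with the MOST RECENT step first; the length of the
-- history is the number of elapsed steps.
Strategy : ℕ → Set → Set
Strategy n H = Fin n → List H → Action n

-- Simultaneous variant: each step records the pair (A's action, B's action)

SimStrategy : ℕ → Set
SimStrategy n = Strategy n (Action n × Action n) × Strategy n (Action n × Action n)

module Simultaneous {n} (σ : SimStrategy n) (a b : Fin n) where
  sA = proj₁ σ
  sB = proj₂ σ

  hist : ℕ → List (Action n × Action n)
  hist zero    = []
  hist (suc t) = (sA b (hist t) , sB a (hist t)) ∷ hist t

  -- A's and B's action at step t+1
  actA : ℕ → Action n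
  actA t = sA b (hist t)
  actB : ℕ → Action n
  actB t = sB a (hist t)

SimCorrect : ∀ {n} → Graph n → SimStrategy n → Set
SimCorrect {n} G σ = ∀ a b → Edge G a b → ∀ t v →
  (Simultaneous.actA σ a b t ≡ just v → v ≡ a) ×
  (Simultaneous.actB σ a b t ≡ just v → v ≡ b)

SimBothAnnounce : ∀ {n} → Graph n → SimStrategy n → Set
SimBothAnnounce {n} G σ = ∀ a b → Edge G a b →
  (∃[ t ] Simultaneous.actA σ a b t ≡ just a) ×
  (∃[ t ] Simultaneous.actB σ a b t ≡ just b)

-- Alternating variant: step t+1 is A's turn when t is even (steps 1,3,5,…)
-- and B's turn when t is odd; each step records the single action taken.

even : ℕ → Bool
even zero    = true
even (suc t) = if even t then false else true

AltStrategy : ℕ → Set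
AltStrategy n = Strategy n (Action n) × Strategy n (Action n)

module Alternating {n} (σ : AltStrategy n) (a b : Fin n) where
  sA = proj₁ σ
  sB = proj₂ σ

  step : ℕ → List (Action n) → Action n
  step t h = if even t then sA b h else sB a h

  hist : ℕ → List (Action n)
  hist zero    = []
  hist (suc t) = step t (hist t) ∷ hist t

  act : ℕ → Action n
  act t = step t (hist t)

AltCorrect : ∀ {n} → Graph n → AltStrategy n → Set
AltCorrect {n} G σ = ∀ a b → Edge G a b → ∀ t v →
  Alternating.act σ a b t ≡ just v →
  (even t ≡ true → v ≡ a) × (even t ≡ false → v ≡ b)

AltBothAnnounce : ∀ {n} → Graph n → AltStrategy n → Set
AltBothAnnounce {n} G σ = ∀ a b → Edge G a b →
  (∃[ t ] (even t ≡ true × Alternating.act σ a b t ≡ just a)) ×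
  (∃[ t ] (even t ≡ false × Alternating.act σ a b t ≡ just b))

-- Peeling leaves off a forest ranks its vertices injectively so that every
-- vertex has at most one neighbour of higher rank; on an edge {l, u} with
-- rk l < rk u the vertex u is therefore determined by l. A player who sees v
-- and has heard nothing by round rk v claims v's higher neighbour: the player
-- on u, who sees l, does so in round rk l and is right. The player on l, who
-- sees u, is still waiting for round rk u > rk l, so the first announcement
-- comes from the other player in round rk l, and the round number tells her
-- that she sits on the vertex of rank rk l. Since each move depends only on
-- earlier ones, the play is the unique solution of the strategy's equations,
-- so it suffices to check that these announcement schedules solve them.
module Submission where

open import Defs
open import Data.Nat using (ℕ; zero; suc; _+_; _≤_; _<_; z≤n; s≤s; s<s⁻¹; ⌊_/2⌋; _<?_; _≤?_)
  renaming (_≟_ to _≟ℕ_)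
open import Data.Nat.Properties
  using (n<1+n; +-comm; +-monoˡ-<; m≤n⇒∃[o]m+o≡n; anyUpTo?; n≮0; 0≢1+n; suc-injective;
         ≤-refl; ≤-trans; ≤-<-trans; n≤1+n; <⇒≤; ≤⇒≯; ≰⇒>; <-cmp; m≤n⇒m<n∨m≡n)
open import Data.Nat.Induction using (<-rec)
open import Data.Fin using (Fin; toℕ; _≟_)
open import Data.Fin.Properties using (pigeonhole; any?)
open import Data.Fin.Subset as Subset using (Subset; _∈_; _-_; _⊂_)
open import Data.Fin.Subset.Properties using (_∈?_; nonempty?; x∈p⇒p-x⊂p; x∈p∧x≢y⇒x∈p-y; ∈⊤)
open import Data.Fin.Subset.Induction using (⊂-wellFounded)
open import Data.Bool using (true; false; if_then_else_)
import Data.Bool as Bool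
open import Data.List using (List; []; _∷_; length; map; drop; applyUpTo; applyDownFrom; last)
open import Data.List.Properties using (length-applyUpTo; length-applyDownFrom; ∷-injectiveˡ)
open import Data.List.Relation.Unary.Unique.Propositional.Properties using (applyUpTo⁺₁)
open import Data.Maybe using (Maybe; just; nothing; _<∣>_)
import Data.Maybe as Maybe
open import Data.Product using (_×_; Σ; ∃; ∃₂; ∃-syntax; _,_; proj₁; proj₂)
open import Data.Sum using (inj₁; inj₂)
open import Data.Empty using (⊥-elim)
open import Function using (_∘_; const)
open import Induction.WellFounded using (Acc; acc)
open import Relation.Binary.Definitions using (tri<; tri≈; tri>)
open import Relation.Binary.PropositionalEquality
  using (_≡_; _≢_; refl; sym; trans; cong; cong₂; subst)
open import Relation.Nullary using (¬_; Dec; yes; no)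
open import Relation.Nullary.Decidable using (_×-dec_; ¬?; decidable-stable)
open import Relation.Unary using (Decidable)

least : ∀ {p} {P : ℕ → Set p} → Decidable P → ∀ {j} → P j →
        ∃ λ m → P m × (∀ {k} → k < m → ¬ P k)
least {P = P} P? {j} = <-rec (λ j → P j → Least) search j
  where
  Least = ∃ λ m → P m × (∀ {k} → k < m → ¬ P k)
  search : ∀ j → (∀ {i} → i < j → P i → Least) → P j → Least
  search j below pj with anyUpTo? P? j
  ... | yes (i , i<j , pi) = below i<j pi
  ... | no none            = j , pj , λ k<j pk → none (_ , k<j , pk)

m<n⇒∃[o]1+o+m≡n : ∀ {m n} → m < n → ∃ λ o → suc o + m ≡ n
m<n⇒∃[o]1+o+m≡n {m} m<n = let o , eq = m≤n⇒∃[o]m+o≡n m<n in o , trans (cong suc (+-comm o m)) eq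

last-applyUpTo : ∀ {a} {A : Set a} (f : ℕ → A) m → last (applyUpTo f (suc m)) ≡ just (f m)
last-applyUpTo f zero    = refl
last-applyUpTo f (suc m) = last-applyUpTo (f ∘ suc) m

module _ {n} (G : Graph n) where

  ¬self-loop : ∀ {v} → ¬ Edge G v v
  ¬self-loop {v} e with trans (sym e) (irrefl G v)
  ... | ()

  record NonBacktrackingWalk (w : ℕ → Fin n) : Set where
    field
      step         : ∀ k → Edge G (w k) (w (suc k))
      no-backtrack : ∀ k → w (suc (suc k)) ≢ w k

  chain-applyUpTo : ∀ {w} → (∀ k → Edge G (w k) (w (suc k))) → ∀ m → Chain G (applyUpTo w (suc m))
  chain-applyUpTo e zero    = one _
  chain-applyUpTo e (suc m) = cons (e 0) (chain-applyUpTo (e ∘ suc) m)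

  closedWalk⇒cycle : ∀ {w} → (∀ k → Edge G (w k) (w (suc k))) → ∀ m → 2 ≤ m →
                     (∀ {i j} → i < j → j < suc m → w i ≢ w j) → w (suc m) ≡ w 0 →
                     IsCycle G (applyUpTo w (suc m))
  closedWalk⇒cycle {w} e m 2≤m distinct closed =
    chain-applyUpTo e m ,
    applyUpTo⁺₁ w (suc m) distinct ,
    subst (3 ≤_) (sym (length-applyUpTo w (suc m))) (s≤s 2≤m) ,
    w 0 , w m , refl , last-applyUpTo w m , subst (Edge G (w m)) closed (e m)

  -- A repetition w i ≡ w j with j least closes a cycle on w i, …, w (j - 1),
  -- of length at least 3 because w has neither loops nor backtracking.
  acyclic⇒¬nonBacktrackingWalk : Acyclic G → ∀ {w} → ¬ NonBacktrackingWalk w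
  acyclic⇒¬nonBacktrackingWalk acyclic {w} walk
    with pigeonhole (n<1+n n) (w ∘ toℕ)
  ... | i₀ , j₀ , i₀<j₀ , repeat₀
    with least (λ j → anyUpTo? (λ i → w i ≟ w j) j) (toℕ i₀ , i₀<j₀ , repeat₀)
  ... | _ , (i , i<m , repeat) , first with m<n⇒∃[o]1+o+m≡n i<m
  ... | zero , refl = ¬self-loop (subst (Edge G (w i)) (sym repeat) (step i))
    where open NonBacktrackingWalk walk
  ... | suc zero , refl = no-backtrack i (sym repeat)
    where open NonBacktrackingWalk walk
  ... | suc (suc d) , refl =
    acyclic (_ , closedWalk⇒cycle (step ∘ (_+ i)) (suc (suc d)) (s≤s (s≤s z≤n))
                   (λ p<q q<3+d eq → first (+-monoˡ-< i q<3+d) (_ , +-monoˡ-< i p<q , eq))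
                   (sym repeat))
    where open NonBacktrackingWalk walk

  Exit : Subset n → Fin n → Fin n → Set
  Exit p x v = ∃ λ b → b ∈ p × Edge G v b × b ≢ x

  exit? : ∀ p x v → Dec (Exit p x v)
  exit? p x v = any? λ b → (b ∈? p) ×-dec (adj G v b Bool.≟ true) ×-dec ¬? (b ≟ x)

  AtMostOneNeighbour : Subset n → Fin n → Set
  AtMostOneNeighbour p v = ∀ {b c} → b ∈ p → c ∈ p → Edge G v b → Edge G v c → b ≡ c

  -- If from every vertex of p one could continue inside p avoiding any given
  -- vertex, there would be a non-backtracking walk through p.
  hasLeaf : Acyclic G → ∀ {p v₀} → v₀ ∈ p → ∃ λ v → v ∈ p × AtMostOneNeighbour p v
  hasLeaf acyclic {p} {v₀} v₀∈p with any? (λ x → any? λ v → (v ∈? p) ×-dec ¬? (exit? p x v))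
  ... | yes (x , v , v∈p , stuck) =
    v , v∈p , λ b∈p c∈p vb vc → trans (only-x b∈p vb) (sym (only-x c∈p vc))
    where
    only-x : ∀ {b} → b ∈ p → Edge G v b → b ≡ x
    only-x b∈p vb = decidable-stable (_ ≟ x) λ b≢x → stuck (_ , b∈p , vb , b≢x)
  ... | no never-stuck = ⊥-elim (acyclic⇒¬nonBacktrackingWalk acyclic walk)
    where
    State : Set
    State = Fin n × Σ (Fin n) (_∈ p)

    exit : ∀ x v → v ∈ p → Exit p x v
    exit x v v∈p = decidable-stable (exit? p x v) λ ¬exit → never-stuck (x , v , v∈p , ¬exit)

    next : State → State
    next (x , v , v∈p) = v , proj₁ (exit x v v∈p) , proj₁ (proj₂ (exit x v v∈p))

    states : ℕ → State
    states zero    = v₀ , v₀ , v₀∈p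
    states (suc k) = next (states k)

    walk : NonBacktrackingWalk (proj₁ ∘ proj₂ ∘ states)
    walk = record
      { step         = λ k → let x , v , v∈p = states k
                             in proj₁ (proj₂ (proj₂ (exit x v v∈p)))
      ; no-backtrack = λ k → let x , v , v∈p = next (states k)
                             in proj₂ (proj₂ (proj₂ (exit x v v∈p)))
      }

  record DegeneracyRank (p : Subset n) (rk : Fin n → ℕ) : Set where
    field
      injective     : ∀ {u v} → u ∈ p → v ∈ p → rk u ≡ rk v → u ≡ v
      higher-unique : ∀ {a b c} → a ∈ p → b ∈ p → c ∈ p → Edge G a b → Edge G a c →
                      rk a < rk b → rk a < rk c → b ≡ c

insertLowest : ∀ {n} → Fin n → (Fin n → ℕ) → Fin n → ℕ
insertLowest v rk u with u ≟ v
... | yes _ = 0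
... | no _  = suc (rk u)

module _ {n} {G : Graph n} where

  insertLeaf : ∀ {p v rk} → v ∈ p → AtMostOneNeighbour G p v →
               DegeneracyRank G (p - v) rk → DegeneracyRank G p (insertLowest v rk)
  insertLeaf {p} {v} {rk} v∈p leaf ranked =
    record { injective = injective ; higher-unique = higher-unique }
    where
    module R = DegeneracyRank ranked

    rest : ∀ {u} → u ∈ p → u ≢ v → u ∈ p - v
    rest = x∈p∧x≢y⇒x∈p-y

    injective : ∀ {u w} → u ∈ p → w ∈ p → insertLowest v rk u ≡ insertLowest v rk w → u ≡ w
    injective {u} {w} u∈p w∈p eq with u ≟ v | w ≟ v
    ... | yes refl | yes refl = refl
    ... | yes refl | no _     = ⊥-elim (0≢1+n eq)
    ... | no _     | yes refl = ⊥-elim (0≢1+n (sym eq))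
    ... | no u≢v   | no w≢v   = R.injective (rest u∈p u≢v) (rest w∈p w≢v) (suc-injective eq)

    higher-unique : ∀ {a b c} → a ∈ p → b ∈ p → c ∈ p → Edge G a b → Edge G a c →
                    insertLowest v rk a < insertLowest v rk b →
                    insertLowest v rk a < insertLowest v rk c → b ≡ c
    higher-unique {a} {b} {c} a∈p b∈p c∈p ab ac a<b a<c with a ≟ v | b ≟ v | c ≟ v
    ... | yes refl | _        | _        = leaf b∈p c∈p ab ac
    ... | no _     | yes refl | _        = ⊥-elim (n≮0 a<b)
    ... | no _     | no _     | yes refl = ⊥-elim (n≮0 a<c)
    ... | no a≢v   | no b≢v   | no c≢v   =
      R.higher-unique (rest a∈p a≢v) (rest b∈p b≢v) (rest c∈p c≢v) ab ac (s<s⁻¹ a<b) (s<s⁻¹ a<c)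

  acyclic⇒degeneracyRank : Acyclic G → ∀ p → Acc _⊂_ p → ∃ (DegeneracyRank G p)
  acyclic⇒degeneracyRank acyclic p (acc smaller) with nonempty? p
  ... | no empty = (λ _ → 0) , record
    { injective     = λ u∈p _ _ → ⊥-elim (empty (_ , u∈p))
    ; higher-unique = λ a∈p _ _ _ _ _ _ → ⊥-elim (empty (_ , a∈p))
    }
  ... | yes (_ , v₀∈p) with hasLeaf G acyclic v₀∈p
  ... | v , v∈p , leaf with acyclic⇒degeneracyRank acyclic (p - v) (smaller (x∈p⇒p-x⊂p v∈p))
  ... | rk , ranked = insertLowest v rk , insertLeaf v∈p leaf ranked

  forest⇒degeneracyRank : Acyclic G → ∃ (DegeneracyRank G Subset.⊤)
  forest⇒degeneracyRank acyclic = acyclic⇒degeneracyRank acyclic Subset.⊤ (⊂-wellFounded _)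

module _ {n : ℕ} where

  announceFrom : ℕ → Fin n → ℕ → Action n
  announceFrom zero     x _       = just x
  announceFrom (suc t₀) x zero    = nothing
  announceFrom (suc t₀) x (suc t) = announceFrom t₀ x t

  announceFrom-on : ∀ {t₀ t} x → t₀ ≤ t → announceFrom t₀ x t ≡ just x
  announceFrom-on {zero}   x _         = refl
  announceFrom-on {suc t₀} x (s≤s le) = announceFrom-on x le

  announceFrom-start : ∀ t₀ x → announceFrom t₀ x t₀ ≡ just x
  announceFrom-start t₀ x = announceFrom-on x (≤-refl {t₀})

  announceFrom-before : ∀ {t₀ t} x → t < t₀ → announceFrom t₀ x t ≡ nothing
  announceFrom-before {suc t₀} {zero}  x _        = refl
  announceFrom-before {suc t₀} {suc t} x (s≤s lt) = announceFrom-before x lt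

  announceFrom-sound : ∀ t₀ {x v} t → announceFrom t₀ x t ≡ just v → v ≡ x
  announceFrom-sound zero     t       refl = refl
  announceFrom-sound (suc t₀) (suc t) eq   = announceFrom-sound t₀ t eq

  -- In a history x ∷ L, listed latest first, the move x was made in round length L.
  firstAnnouncement : List (Action n) → Maybe ℕ
  firstAnnouncement []      = nothing
  firstAnnouncement (x ∷ L) = firstAnnouncement L <∣> Maybe.map (const (length L)) x

  firstAnnouncement-before : ∀ {t₀ m} x → m ≤ t₀ →
                             firstAnnouncement (applyDownFrom (announceFrom t₀ x) m) ≡ nothing
  firstAnnouncement-before {m = zero}  x _  = refl
  firstAnnouncement-before {t₀} {suc m} x le
    rewrite firstAnnouncement-before x (<⇒≤ le) | announceFrom-before x le = refl

  firstAnnouncement-after : ∀ {t₀ m} x → t₀ < m →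
                            firstAnnouncement (applyDownFrom (announceFrom t₀ x) m) ≡ just t₀
  firstAnnouncement-after {t₀} {suc m} x (s≤s le) with m≤n⇒m<n∨m≡n le
  ... | inj₁ lt   rewrite firstAnnouncement-after x lt = refl
  ... | inj₂ refl rewrite firstAnnouncement-before x (≤-refl {m}) | announceFrom-on x (≤-refl {m})
                        | length-applyDownFrom (announceFrom m x) m = refl

module _ {a} {X : Set a} where

  record Play (rA rB : List X → ℕ → X) (xA xB : ℕ → X) : Set a where
    constructor play
    field
      answerA : ∀ k → rA (applyDownFrom xB k) k ≡ xA k
      answerB : ∀ k → rB (applyDownFrom xA (suc k)) k ≡ xB k

  play-prefixes : ∀ {rA rB xA xB yA yB} → Play rA rB xA xB → Play rA rB yA yB →
                  ∀ k → applyDownFrom xA k ≡ applyDownFrom yA k × applyDownFrom xB k ≡ applyDownFrom yB k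
  play-prefixes _ _ zero = refl , refl
  play-prefixes {rA} {rB} {xA} {xB} {yA} {yB} x@(play xA≡ xB≡) y@(play yA≡ yB≡) (suc k) =
    prefixA , prefixB
    where
    before = play-prefixes x y k
    prefixA : applyDownFrom xA (suc k) ≡ applyDownFrom yA (suc k)
    prefixA = cong₂ _∷_ (trans (sym (xA≡ k)) (trans (cong (λ L → rA L k) (proj₂ before)) (yA≡ k)))
                        (proj₁ before)
    prefixB : applyDownFrom xB (suc k) ≡ applyDownFrom yB (suc k)
    prefixB = cong₂ _∷_ (trans (sym (xB≡ k)) (trans (cong (λ L → rB L k) prefixA) (yB≡ k)))
                        (proj₂ before)

  play-unique : ∀ {rA rB xA xB yA yB} → Play rA rB xA xB → Play rA rB yA yB →
                ∀ k → xA k ≡ yA k × xB k ≡ yB k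
  play-unique x y k = let A , B = play-prefixes x y (suc k) in ∷-injectiveˡ A , ∷-injectiveˡ B

true≢false : true ≢ false
true≢false ()

twice : ℕ → ℕ
twice zero    = zero
twice (suc k) = suc (suc (twice k))

data Parity : ℕ → Set where
  even-round : ∀ k → Parity (twice k)
  odd-round  : ∀ k → Parity (suc (twice k))

parity : ∀ t → Parity t
parity zero = even-round zero
parity (suc t) with parity t
... | even-round k = odd-round k
... | odd-round k  = even-round (suc k)

even-twice : ∀ k → even (twice k) ≡ true
even-twice zero = refl
even-twice (suc k) rewrite even-twice k = refl

even-suc-twice : ∀ k → even (suc (twice k)) ≡ false
even-suc-twice k rewrite even-twice k = refl

⌊twice/2⌋ : ∀ k → ⌊ twice k /2⌋ ≡ k
⌊twice/2⌋ zero    = refl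
⌊twice/2⌋ (suc k) = cong suc (⌊twice/2⌋ k)

⌊suc-twice/2⌋ : ∀ k → ⌊ suc (twice k) /2⌋ ≡ k
⌊suc-twice/2⌋ zero    = refl
⌊suc-twice/2⌋ (suc k) = cong suc (⌊suc-twice/2⌋ k)

everyOther : ∀ {a} {A : Set a} → List A → List A
everyOther []           = []
everyOther (x ∷ [])     = x ∷ []
everyOther (x ∷ _ ∷ xs) = x ∷ everyOther xs

module _ {a} {A : Set a} (f : ℕ → A) where

  everyOther-twice : ∀ k → everyOther (applyDownFrom f (twice k)) ≡ applyDownFrom (f ∘ suc ∘ twice) k
  everyOther-twice zero    = refl
  everyOther-twice (suc k) = cong (f (suc (twice k)) ∷_) (everyOther-twice k)

  everyOther-suc-twice : ∀ k →
    everyOther (applyDownFrom f (suc (twice k))) ≡ applyDownFrom (f ∘ twice) (suc k)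
  everyOther-suc-twice zero    = refl
  everyOther-suc-twice (suc k) = cong (f (twice (suc k)) ∷_) (everyOther-suc-twice k)

module Protocol {n} (G : Graph n) (rk : Fin n → ℕ) (ranked : DegeneracyRank G Subset.⊤ rk) where
  open DegeneracyRank ranked

  higherNeighbour : Fin n → Fin n
  higherNeighbour a with any? (λ b → (adj G a b Bool.≟ true) ×-dec (rk a <? rk b))
  ... | yes (b , _) = b
  ... | no _        = a

  higherNeighbour-unique : ∀ {a b} → Edge G a b → rk a < rk b → higherNeighbour a ≡ b
  higherNeighbour-unique {a} {b} ab a<b with any? (λ b → (adj G a b Bool.≟ true) ×-dec (rk a <? rk b))
  ... | yes (c , ac , a<c) = higher-unique ∈⊤ ∈⊤ ∈⊤ ac ab a<c a<b
  ... | no none            = ⊥-elim (none (b , ab , a<b))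

  ofRank : ℕ → Action n
  ofRank s with any? (λ w → rk w ≟ℕ s)
  ... | yes (w , _) = just w
  ... | no _        = nothing

  ofRank-rk : ∀ w → ofRank (rk w) ≡ just w
  ofRank-rk w with any? (λ v → rk v ≟ℕ rk w)
  ... | yes (v , eq) = cong just (injective ∈⊤ ∈⊤ eq)
  ... | no none      = ⊥-elim (none (w , refl))

  reply : Fin n → Maybe ℕ → ℕ → Action n
  reply v (just s) now with s <? rk v
  ... | yes _ = ofRank s
  ... | no _  = announceFrom (rk v) (higherNeighbour v) now
  reply v nothing now = announceFrom (rk v) (higherNeighbour v) now

  respond : Fin n → List (Action n) → ℕ → Action n
  respond v L = reply v (firstAnnouncement L)

  respond-seesLower : ∀ {l u t₀} → Edge G l u → rk l < rk u → rk l ≤ t₀ → ∀ x m now →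
                  respond l (applyDownFrom (announceFrom t₀ x) m) now ≡ announceFrom (rk l) u now
  respond-seesLower {l} {u} {t₀} lu l<u l≤t₀ x m now with m ≤? t₀
  ... | yes m≤t₀ rewrite firstAnnouncement-before x m≤t₀ =
    cong (λ y → announceFrom (rk l) y now) (higherNeighbour-unique lu l<u)
  ... | no m≰t₀ rewrite firstAnnouncement-after x (≰⇒> m≰t₀) with t₀ <? rk l
  ...   | yes t₀<l = ⊥-elim (≤⇒≯ l≤t₀ t₀<l)
  ...   | no _     = cong (λ y → announceFrom (rk l) y now) (higherNeighbour-unique lu l<u)

  respond-seesHigher : ∀ {l u} → rk l < rk u → ∀ x m now → now ≤ m →
                  respond u (applyDownFrom (announceFrom (rk l) x) m) now ≡ announceFrom (suc (rk l)) l m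
  respond-seesHigher {l} {u} l<u x m now now≤m with m ≤? rk l
  ... | yes m≤l rewrite firstAnnouncement-before x m≤l =
    trans (announceFrom-before _ (≤-<-trans (≤-trans now≤m m≤l) l<u))
          (sym (announceFrom-before l (s≤s m≤l)))
  ... | no m≰l rewrite firstAnnouncement-after x (≰⇒> m≰l) with rk l <? rk u
  ...   | yes _    = trans (ofRank-rk l) (sym (announceFrom-on l (≰⇒> m≰l)))
  ...   | no l≮u   = ⊥-elim (l≮u l<u)

  distinct-ranks : ∀ {a b} → Edge G a b → rk a ≢ rk b
  distinct-ranks {a} ab eq = ¬self-loop G (subst (Edge G a) (sym (injective ∈⊤ ∈⊤ eq)) ab)

  simStrategy : SimStrategy n
  simStrategy = (λ b h → respond b (map proj₂ h) (length h))
              , (λ a h → respond a (map proj₁ h) (length h))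

  -- In an alternating history, listed latest first, the opponent's moves are
  -- exactly those at even positions.
  altStrategy : AltStrategy n
  altStrategy = (λ b h → respond b (everyOther h) ⌊ length h /2⌋)
              , (λ a h → respond a (everyOther h) ⌊ length h /2⌋)

  module _ {a b : Fin n} where
    private
      module S = Simultaneous simStrategy a b
      module T = Alternating altStrategy a b

    sim-movesA : ∀ t → map proj₁ (S.hist t) ≡ applyDownFrom S.actA t
    sim-movesA zero    = refl
    sim-movesA (suc t) = cong (S.actA t ∷_) (sim-movesA t)

    sim-movesB : ∀ t → map proj₂ (S.hist t) ≡ applyDownFrom S.actB t
    sim-movesB zero    = refl
    sim-movesB (suc t) = cong (S.actB t ∷_) (sim-movesB t)

    sim-length : ∀ t → length (S.hist t) ≡ t
    sim-length zero    = refl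
    sim-length (suc t) = cong suc (sim-length t)

    -- B does not hear A's move of the current round, which drop 1 forgets.
    sim-play : Play (respond b) (λ L → respond a (drop 1 L)) S.actA S.actB
    sim-play = play (λ t → sym (cong₂ (respond b) (sim-movesB t) (sim-length t)))
                    (λ t → sym (cong₂ (respond a) (sim-movesA t) (sim-length t)))

    alt-history : ∀ t → T.hist t ≡ applyDownFrom T.act t
    alt-history zero    = refl
    alt-history (suc t) = cong (T.act t ∷_) (alt-history t)

    alt-length : ∀ t → length (T.hist t) ≡ t
    alt-length zero    = refl
    alt-length (suc t) = cong suc (alt-length t)

    alt-turnA : ∀ k → T.act (twice k) ≡ T.sA b (T.hist (twice k))
    alt-turnA k = cong (λ e → if e then T.sA b h else T.sB a h) (even-twice k)
      where h = T.hist (twice k)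

    alt-turnB : ∀ k → T.act (suc (twice k)) ≡ T.sB a (T.hist (suc (twice k)))
    alt-turnB k = cong (λ e → if e then T.sA b h else T.sB a h) (even-suc-twice k)
      where h = T.hist (suc (twice k))

    alt-play : Play (respond b) (respond a) (T.act ∘ twice) (T.act ∘ suc ∘ twice)
    alt-play = play (λ k → sym (trans (alt-turnA k) (cong₂ (respond b) (movesB k) (roundA k))))
                    (λ k → sym (trans (alt-turnB k) (cong₂ (respond a) (movesA k) (roundB k))))
      where
      movesB : ∀ k → everyOther (T.hist (twice k)) ≡ applyDownFrom (T.act ∘ suc ∘ twice) k
      movesB k = trans (cong everyOther (alt-history (twice k))) (everyOther-twice T.act k)
      movesA : ∀ k → everyOther (T.hist (suc (twice k))) ≡ applyDownFrom (T.act ∘ twice) (suc k)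
      movesA k = trans (cong everyOther (alt-history (suc (twice k)))) (everyOther-suc-twice T.act k)
      roundA : ∀ k → ⌊ length (T.hist (twice k)) /2⌋ ≡ k
      roundA k = trans (cong ⌊_/2⌋ (alt-length (twice k))) (⌊twice/2⌋ k)
      roundB : ∀ k → ⌊ length (T.hist (suc (twice k))) /2⌋ ≡ k
      roundB k = trans (cong ⌊_/2⌋ (alt-length (suc (twice k)))) (⌊suc-twice/2⌋ k)

    module _ (ab : Edge G a b) where

      sim-outcome : ∃₂ λ tA tB →
                    ∀ t → S.actA t ≡ announceFrom tA a t × S.actB t ≡ announceFrom tB b t
      sim-outcome with <-cmp (rk a) (rk b)
      ... | tri< a<b _ _ = suc (rk a) , rk a , play-unique sim-play
            (play (λ t → respond-seesHigher a<b b t t ≤-refl)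
                  (λ t → respond-seesLower ab a<b (n≤1+n _) a t t))
      ... | tri≈ _ eq _  = ⊥-elim (distinct-ranks ab eq)
      ... | tri> _ _ b<a = rk b , suc (rk b) , play-unique sim-play
            (play (λ t → respond-seesLower (symm G a b ab) b<a (n≤1+n _) b t t)
                  (λ t → respond-seesHigher b<a a t t ≤-refl))

      alt-outcome : ∃₂ λ tA tB →
                    ∀ k → T.act (twice k) ≡ announceFrom tA a k × T.act (suc (twice k)) ≡ announceFrom tB b k
      alt-outcome with <-cmp (rk a) (rk b)
      ... | tri< a<b _ _ = suc (rk a) , rk a , play-unique alt-play
            (play (λ k → respond-seesHigher a<b b k k ≤-refl)
                  (λ k → respond-seesLower ab a<b (n≤1+n _) a (suc k) k))
      ... | tri≈ _ eq _  = ⊥-elim (distinct-ranks ab eq)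
      ... | tri> _ _ b<a = rk b , rk b , play-unique alt-play
            (play (λ k → respond-seesLower (symm G a b ab) b<a ≤-refl b k k)
                  (λ k → respond-seesHigher b<a a (suc k) k (n≤1+n k)))

  sim-correct : SimCorrect G simStrategy
  sim-correct a b ab t v with sim-outcome ab
  ... | tA , tB , outcome = (λ eq → announceFrom-sound tA t (trans (sym (proj₁ (outcome t))) eq))
                          , (λ eq → announceFrom-sound tB t (trans (sym (proj₂ (outcome t))) eq))

  sim-announces : SimBothAnnounce G simStrategy
  sim-announces a b ab with sim-outcome ab
  ... | tA , tB , outcome = (tA , trans (proj₁ (outcome tA)) (announceFrom-start tA a))
                          , (tB , trans (proj₂ (outcome tB)) (announceFrom-start tB b))

  alt-correct : AltCorrect G altStrategy
  alt-correct a b ab t v eq with alt-outcome ab | parity t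
  ... | tA , tB , outcome | even-round k =
      (λ _ → announceFrom-sound tA k (trans (sym (proj₁ (outcome k))) eq))
    , (λ odd → ⊥-elim (true≢false (trans (sym (even-twice k)) odd)))
  ... | tA , tB , outcome | odd-round k =
      (λ ev → ⊥-elim (true≢false (trans (sym ev) (even-suc-twice k))))
    , (λ _ → announceFrom-sound tB k (trans (sym (proj₂ (outcome k))) eq))

  alt-announces : AltBothAnnounce G altStrategy
  alt-announces a b ab with alt-outcome ab
  ... | tA , tB , outcome =
      (twice tA , even-twice tA , trans (proj₁ (outcome tA)) (announceFrom-start tA a))
    , (suc (twice tB) , even-suc-twice tB , trans (proj₂ (outcome tB)) (announceFrom-start tB b))

proposition2p7 : ∀ {n} (G : Graph n) → IsTree G →
    (∃[ σ ] (SimCorrect G σ × SimBothAnnounce G σ)) ×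
    (∃[ σ ] (AltCorrect G σ × AltBothAnnounce G σ))
proposition2p7 G (_ , acyclic) with forest⇒degeneracyRank acyclic
... | rk , ranked = (simStrategy , sim-correct , sim-announces)
                  , (altStrategy , alt-correct , alt-announces)
  where open Protocol G rk ranked
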